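{- Consider preference trees $T$ together with two sight functions $s_1,s_2$ for $T$ satisfying $s_1(h)\subseteq s_2(h)$ for every history $h$, and let $z_1$ be an SCBI history of $(T,s_1)$ and $z_2$ an SCBI history of $(T,s_2)$. Each of the following three cases can occur (i.e. for each case there exist such $T,s_1,s_2,z_1,z_2$ realizing it): (a) $z_1\succ z_2$; (b) $z_2\succ z_1$; (c) $z_1\sim z_2$.
   Context: A preference tree is a pair $T=(H,\succeq)$ where $H$ is a nonempty set of finite sequences of actions (histories) containing the empty sequence $\varepsilon$ and closed under prefixes, and $\succeq$ is a total (complete, transitive) preference relation on all of $H$; $\succ$, $\sim$ are its strict and indifference parts. $h\lhd h'$ means $h$ is a prefix of $h'$; $(ha)$ is $h$ extended by action $a$; $Z$ is the set of terminal histories; $H|_h$ is the set of histories extending $h$ (including $h$). A sight function assigns to each $h$ a nonempty finite $s(h)\subseteq H|_h$ such that (DC) if $h\lhd h'\lhd h''$ and $h''\in s(h)$ then $h'\in s(h)$, and (NF) if $h\lhd h'\lhd h''$ and $h''\in s(h)$ then $h''\in s(h')$. For a sight function $s$, $Z_h$ denotes the elements of $s(h)$ with no proper extension in $s(h)$; $\max_{\succeq}\Gamma=\{g\in\Gamma: g\succeq g'\ \forall g'\in\Gamma\}$. An SCBI history of $(T,s)$ is an $h^*\in Z$ such that for every proper prefix $h$ of $h^*$, with $a$ the action such that $(ha)\lhd h^*$, there is $z\in\max_{\succeq}Z_h$ with $(ha)\lhd z$. -}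

module Defs where

open import Data.List using (List; []; _∷_; _++_; _∷ʳ_)
open import Data.List.Membership.Propositional using (_∈_)
open import Data.Product using (Σ; ∃; ∃-syntax; _×_; _,_)
open import Data.Sum using (_⊎_)
open import Relation.Nullary using (¬_)
open import Relation.Binary.PropositionalEquality using (_≡_)

_⊲_ : {A : Set} → List A → List A → Set
h ⊲ h' = ∃[ t ] (h ++ t ≡ h')

_⊲⁺_ : {A : Set} → List A → List A → Set
h ⊲⁺ h' = ∃[ a ] ∃[ t ] (h ++ (a ∷ t) ≡ h')

record PrefTree (A : Set) : Set₁ where
  field
    H      : List A → Set
    _≽_    : List A → List A → Set
    H-ε    : H []
    H-pref : ∀ {h h'} → h ⊲ h' → H h' → H h
    ≽-total : ∀ {g g'} → H g → H g' → (g ≽ g') ⊎ (g' ≽ g)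
    ≽-trans : ∀ {g g' g''} → H g → H g' → H g'' → g ≽ g' → g' ≽ g'' → g ≽ g''

  _≻_ : List A → List A → Set
  g ≻ g' = (g ≽ g') × ¬ (g' ≽ g)

  _∼_ : List A → List A → Set
  g ∼ g' = (g ≽ g') × (g' ≽ g)

  Terminal : List A → Set
  Terminal h = H h × (∀ a → ¬ H (h ∷ʳ a))

open PrefTree public

record SightFn {A : Set} (T : PrefTree A) : Set where
  field
    s        : List A → List (List A)
    nonempty : ∀ {h} → H T h → ∃[ g ] (g ∈ s h)
    sub-H    : ∀ {h g} → H T h → g ∈ s h → H T g
    sub-ext  : ∀ {h g} → H T h → g ∈ s h → h ⊲ g
    DC       : ∀ {h h' h''} → H T h → h ⊲ h' → h' ⊲ h'' → h'' ∈ s h → h' ∈ s h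
    NF       : ∀ {h h' h''} → H T h → h ⊲ h' → h' ⊲ h'' → h'' ∈ s h → h'' ∈ s h'

open SightFn public

module _ {A : Set} (T : PrefTree A) (σ : SightFn T) where
  Zh : List A → List A → Set
  Zh h g = g ∈ s σ h × (∀ g' → g ⊲⁺ g' → ¬ (g' ∈ s σ h))

  MaxZh : List A → List A → Set
  MaxZh h g = Zh h g × (∀ g' → Zh h g' → _≽_ T g g')

  SCBI : List A → Set
  SCBI z = Terminal T z ×
           (∀ h a → (h ∷ʳ a) ⊲ z → ∃[ z' ] (MaxZh h z' × (h ∷ʳ a) ⊲ z'))

_⊆ˢ_ : {A : Set} {T : PrefTree A} → SightFn T → SightFn T → Set
_⊆ˢ_ {A} {T} σ₁ σ₂ = ∀ h g → H T h → g ∈ s σ₁ h → g ∈ s σ₂ h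

Realizable : ((A : Set) → PrefTree A → List A → List A → Set) → Set₁
Realizable R =
  Σ Set λ A → Σ (PrefTree A) λ T → Σ (SightFn T) λ σ₁ → Σ (SightFn T) λ σ₂ →
  Σ (List A) λ z₁ → Σ (List A) λ z₂ →
  (σ₁ ⊆ˢ σ₂) × SCBI T σ₁ z₁ × SCBI T σ₂ z₂ × R A T z₁ z₂

-- A single path offers an exit with payoff 2 at the root and otherwise runs
-- through payoffs 1 and 3 to a terminal history of payoff c.  With one step of
-- sight the player compares the exit (2) with the dip (1) and leaves at once;
-- with two steps it sees the 3 behind the dip, enters, and afterwards the
-- terminal payoff c is in sight.  Taking c below, above or equal to 2 gives the
-- three cases, with horizon-one sight contained in horizon-two sight.
module Submission where

open import Defs
open import Data.Bool using (Bool; true; false)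
import Data.Bool as Bool
open import Data.Empty using (⊥-elim)
open import Data.List using (List; []; _∷_; _∷ʳ_; [_]; length; filter)
open import Data.List.Properties using (length-++; ++-identityʳ; ++-assoc)
open import Data.List.Membership.Propositional using (_∈_)
open import Data.List.Membership.Propositional.Properties using (∈-filter⁺; ∈-filter⁻)
open import Data.List.Relation.Unary.Any using (here; there)
open import Data.Nat using (ℕ; _+_; _≤_; _<_; _≤?_; z≤n; s≤s; z<s; s<s)
open import Data.Nat.Properties
  using (≤-total; ≤-trans; ≤-refl; m≤m+n; m<m+n; +-monoˡ-≤; +-monoʳ-≤; <⇒≤; <⇒≱)
open import Data.Product using (_×_; _,_; proj₁; proj₂; ∃-syntax)
open import Data.Sum using (_⊎_; inj₁; inj₂; [_,_]′)
open import Function using (id)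
open import Relation.Binary.Definitions using (Decidable; DecidableEquality)
open import Relation.Binary.PropositionalEquality using (_≡_; refl; sym)
open import Relation.Nullary using (Dec; yes; no)
open import Relation.Nullary.Decidable using (_×-dec_)

module _ {A : Set} where

  ⊲-length : {h g : List A} → h ⊲ g → length h ≤ length g
  ⊲-length {h} (t , refl) rewrite length-++ h {t} = m≤m+n (length h) (length t)

  ⊲⁺-length : {h g : List A} → h ⊲⁺ g → length h < length g
  ⊲⁺-length {h} (a , t , refl) rewrite length-++ h {a ∷ t} = m<m+n (length h) z<s

  ⊲⇒≡⊎⊲⁺ : {h g : List A} → h ⊲ g → h ≡ g ⊎ h ⊲⁺ g
  ⊲⇒≡⊎⊲⁺ {h} ([] , refl) = inj₁ (sym (++-identityʳ h))
  ⊲⇒≡⊎⊲⁺ (a ∷ t , h++a∷t≡g) = inj₂ (a , t , h++a∷t≡g)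

  ⊲⁺⇒∷ʳ⊲ : {h g : List A} → h ⊲⁺ g → ∃[ a ] (h ∷ʳ a) ⊲ g
  ⊲⁺⇒∷ʳ⊲ {h} (a , t , refl) = a , t , ++-assoc h [ a ] t

  ⊲-dec : DecidableEquality A → Decidable (_⊲_ {A})
  ⊲-dec _≟_ [] g = yes (g , refl)
  ⊲-dec _≟_ (x ∷ h) [] = no λ { (_ , ()) }
  ⊲-dec _≟_ (x ∷ h) (y ∷ g) with x ≟ y | ⊲-dec _≟_ h g
  ... | yes refl | yes (t , refl) = yes (t , refl)
  ... | yes refl | no h⋬g = no λ { (t , refl) → h⋬g (t , refl) }
  ... | no x≢y   | _ = no λ { (_ , refl) → x≢y refl }

≽-refl : ∀ {A} (T : PrefTree A) {g} → H T g → _≽_ T g g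
≽-refl T Hg = [ id , id ]′ (≽-total T Hg Hg)

module _ {A : Set} (T : PrefTree A) (σ : SightFn T) where

  terminal⇒Zh : ∀ {h z} → H T h → Terminal T z → z ∈ s σ h → Zh T σ h z
  terminal⇒Zh Hh (_ , z-terminal) z∈ = z∈ , λ g z⊲⁺g g∈ →
    let (a , za⊲g) = ⊲⁺⇒∷ʳ⊲ z⊲⁺g in z-terminal a (H-pref T za⊲g (sub-H σ Hh g∈))

  -- z is then the only element of Z_h.
  terminal-path⇒MaxZh : ∀ {h z} → H T h → Terminal T z → z ∈ s σ h →
                        (∀ {g} → g ∈ s σ h → g ⊲ z) → MaxZh T σ h z
  terminal-path⇒MaxZh Hh z-terminal z∈ on-path =
    terminal⇒Zh Hh z-terminal z∈ , λ g (g∈ , g-maximal) →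
      [ (λ { refl → ≽-refl T (proj₁ z-terminal) })
      , (λ g⊲⁺z → ⊥-elim (g-maximal _ g⊲⁺z z∈)) ]′ (⊲⇒≡⊎⊲⁺ (on-path g∈))

module Horizon {A : Set} (_≟_ : DecidableEquality A) (T : PrefTree A)
               (histories : List (List A))
               (complete : ∀ {h} → H T h → h ∈ histories)
               (sound : ∀ {h} → h ∈ histories → H T h) where

  Within : ℕ → List A → List A → Set
  Within d h g = h ⊲ g × length g ≤ length h + d

  within? : ∀ d h g → Dec (Within d h g)
  within? d h g = ⊲-dec _≟_ h g ×-dec (length g ≤? length h + d)

  visible : ℕ → List A → List (List A)
  visible d h = filter (within? d h) histories

  visible⁺ : ∀ {d h g} → g ∈ histories → Within d h g → g ∈ visible d h
  visible⁺ {d} {h} = ∈-filter⁺ (within? d h)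

  visible⁻ : ∀ {d h g} → g ∈ visible d h → g ∈ histories × Within d h g
  visible⁻ {d} {h} = ∈-filter⁻ (within? d h) {xs = histories}

  horizon : ℕ → SightFn T
  horizon d = record
    { s        = visible d
    ; nonempty = λ {h} Hh →
        h , visible⁺ (complete Hh) (([] , ++-identityʳ h) , m≤m+n (length h) d)
    ; sub-H    = λ _ g∈ → sound (proj₁ (visible⁻ g∈))
    ; sub-ext  = λ _ g∈ → proj₁ (proj₂ (visible⁻ g∈))
    ; DC       = λ _ h⊲h′ h′⊲h″ h″∈ →
        let (h″∈H , _ , short) = visible⁻ h″∈ in
        visible⁺ (complete (H-pref T h′⊲h″ (sound h″∈H)))
                  (h⊲h′ , ≤-trans (⊲-length h′⊲h″) short)
    ; NF       = λ _ h⊲h′ h′⊲h″ h″∈ →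
        let (h″∈H , _ , short) = visible⁻ h″∈ in
        visible⁺ h″∈H (h′⊲h″ , ≤-trans short (+-monoˡ-≤ d (⊲-length h⊲h′)))
    }

  horizon-mono : ∀ {d e} → d ≤ e → horizon d ⊆ˢ horizon e
  horizon-mono d≤e h g _ g∈ =
    let (g∈H , h⊲g , short) = visible⁻ g∈ in
    visible⁺ g∈H (h⊲g , ≤-trans short (+-monoʳ-≤ (length h) d≤e))

  horizon-frontier⇒Zh : ∀ {d h g} → length h + d ≤ length g →
                        g ∈ s (horizon d) h → Zh T (horizon d) h g
  horizon-frontier⇒Zh far g∈ = g∈ , λ g′ g⊲⁺g′ g′∈ →
    let (_ , _ , short) = visible⁻ g′∈ in
    <⇒≱ (⊲⁺-length g⊲⁺g′) (≤-trans short far)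

pattern stop = false
pattern go   = true

isHistory : List Bool → Bool
isHistory []                  = true
isHistory (stop ∷ [])         = true
isHistory (go ∷ [])           = true
isHistory (go ∷ go ∷ [])      = true
isHistory (go ∷ go ∷ go ∷ []) = true
isHistory _                   = false

IsHistory : List Bool → Set
IsHistory h = isHistory h ≡ true

exit dip peak end : List Bool
exit = stop ∷ []
dip  = go ∷ []
peak = go ∷ go ∷ []
end  = go ∷ go ∷ go ∷ []

histories : List (List Bool)
histories = [] ∷ exit ∷ dip ∷ peak ∷ end ∷ []

histories-complete : ∀ {h} → IsHistory h → h ∈ histories
histories-complete {[]}                  _ = here refl
histories-complete {stop ∷ []}           _ = there (here refl)
histories-complete {go ∷ []}             _ = there (there (here refl))
histories-complete {go ∷ go ∷ []}        _ = there (there (there (here refl)))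
histories-complete {go ∷ go ∷ go ∷ []}   _ = there (there (there (there (here refl))))
histories-complete {stop ∷ _ ∷ _}        ()
histories-complete {go ∷ stop ∷ _}       ()
histories-complete {go ∷ go ∷ stop ∷ _}  ()
histories-complete {go ∷ go ∷ go ∷ _ ∷ _} ()

histories-sound : ∀ {h} → h ∈ histories → IsHistory h
histories-sound (here refl)                                 = refl
histories-sound (there (here refl))                         = refl
histories-sound (there (there (here refl)))                 = refl
histories-sound (there (there (there (here refl))))         = refl
histories-sound (there (there (there (there (here refl))))) = refl

IsHistory-prefix-closed : ∀ {h h′} → h ⊲ h′ → IsHistory h′ → IsHistory h
IsHistory-prefix-closed {[]}                  _ _ = refl
IsHistory-prefix-closed {stop ∷ []}           _ _ = refl
IsHistory-prefix-closed {go ∷ []}             _ _ = refl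
IsHistory-prefix-closed {go ∷ go ∷ []}        _ _ = refl
IsHistory-prefix-closed {go ∷ go ∷ go ∷ []}   _ _ = refl
IsHistory-prefix-closed {stop ∷ _ ∷ _}        (_ , refl) ()
IsHistory-prefix-closed {go ∷ stop ∷ _}       (_ , refl) ()
IsHistory-prefix-closed {go ∷ go ∷ stop ∷ _}  (_ , refl) ()
IsHistory-prefix-closed {go ∷ go ∷ go ∷ _ ∷ _} (_ , refl) ()

module Game (c : ℕ) where

  payoff : List Bool → ℕ
  payoff (stop ∷ _)         = 2
  payoff (go ∷ [])          = 1
  payoff (go ∷ go ∷ [])     = 3
  payoff (go ∷ go ∷ go ∷ _) = c
  payoff _                  = 0

  game : PrefTree Bool
  game = record
    { H       = IsHistory
    ; _≽_     = λ g g′ → payoff g′ ≤ payoff g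
    ; H-ε     = refl
    ; H-pref  = IsHistory-prefix-closed
    ; ≽-total = λ {g} {g′} _ _ → ≤-total (payoff g′) (payoff g)
    ; ≽-trans = λ _ _ _ g≽g′ g′≽g″ → ≤-trans g′≽g″ g≽g′
    }

  ≻-from-payoff : ∀ {g g′} → payoff g′ < payoff g → _≻_ game g g′
  ≻-from-payoff p = <⇒≤ p , <⇒≱ p

  open Horizon Bool._≟_ game histories histories-complete histories-sound

  myopic farsighted : SightFn game
  myopic     = horizon 1
  farsighted = horizon 2

  exit-terminal : Terminal game exit
  exit-terminal = refl , λ { stop (); go () }

  end-terminal : Terminal game end
  end-terminal = refl , λ { stop (); go () }

  myopic-root : MaxZh game myopic [] exit
  myopic-root =
    terminal⇒Zh game myopic {h = []} refl exit-terminal (there (here refl)) , λ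
      { _ (here refl , _)                 → z≤n
      ; _ (there (here refl) , _)         → ≤-refl
      ; _ (there (there (here refl)) , _) → s≤s z≤n
      }

  myopic-scbi : SCBI game myopic exit
  myopic-scbi = exit-terminal , λ
    { [] _ (_ , refl)        → exit , myopic-root , ([] , refl)
    ; (_ ∷ []) _ (_ , ())
    ; (_ ∷ _ ∷ _) _ (_ , ())
    }

  farsighted-root : MaxZh game farsighted [] peak
  farsighted-root =
    horizon-frontier⇒Zh {h = []} ≤-refl (there (there (there (here refl)))) , λ
      { _ (here refl , _)                         → z≤n
      ; _ (there (here refl) , _)                 → s≤s (s≤s z≤n)
      ; _ (there (there (here refl)) , _)         → s≤s z≤n
      ; _ (there (there (there (here refl))) , _) → ≤-refl
      }

  farsighted-dip : MaxZh game farsighted dip end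
  farsighted-dip =
    terminal-path⇒MaxZh game farsighted {h = dip} refl end-terminal (there (there (here refl))) λ
      { (here refl)                 → go ∷ go ∷ [] , refl
      ; (there (here refl))         → go ∷ [] , refl
      ; (there (there (here refl))) → [] , refl
      }

  farsighted-peak : MaxZh game farsighted peak end
  farsighted-peak =
    terminal-path⇒MaxZh game farsighted {h = peak} refl end-terminal (there (here refl)) λ
      { (here refl)         → go ∷ [] , refl
      ; (there (here refl)) → [] , refl
      }

  farsighted-scbi : SCBI game farsighted end
  farsighted-scbi = end-terminal , λ
    { [] _ (_ , refl)               → peak , farsighted-root , (go ∷ [] , refl)
    ; (_ ∷ []) _ (_ , refl)         → end , farsighted-dip , (go ∷ [] , refl)
    ; (_ ∷ _ ∷ []) _ (_ , refl)     → end , farsighted-peak , ([] , refl)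
    ; (_ ∷ _ ∷ _ ∷ []) _ (_ , ())
    ; (_ ∷ _ ∷ _ ∷ _ ∷ _) _ (_ , ())
    }

  realize : {R : (A : Set) → PrefTree A → List A → List A → Set} →
            R Bool game exit end → Realizable R
  realize r = Bool , game , myopic , farsighted , exit , end
            , horizon-mono (s≤s z≤n) , myopic-scbi , farsighted-scbi , r

mainTheorem2 : Realizable (λ A T z₁ z₂ → _≻_ T z₁ z₂)
             × Realizable (λ A T z₁ z₂ → _≻_ T z₂ z₁)
             × Realizable (λ A T z₁ z₂ → _∼_ T z₁ z₂)
mainTheorem2 = Game.realize 0 (Game.≻-from-payoff 0 {exit} {end} z<s)
             , Game.realize 4 (Game.≻-from-payoff 4 {end} {exit} (s<s (s<s z<s)))
             , Game.realize 2 (≤-refl , ≤-refl)
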